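{- Let $q\geq 2$ be a prime power, $d\geq 6$, $b=-q$, $j=1$ and $1\leq i\leq d-1$. Then $|Q_1(i)|>|Q_1(i+1)|$. Moreover, the sign of $Q_1(i)$ equals the sign of $T_{h_{\max}}(i,1)$, where $h_{\max}=\min\{1,d-i\}$.
   Context: For integers $m\geq 0$ and $l$, ${m \brack l}_b=\prod_{t=1}^{l}\frac{(-q)^{m-t+1}-1}{(-q)^t-1}$ for $0\leq l\leq m$, and $0$ if $l<0$ or $l>m$. For $0\le i,j\le d$ and $h\geq 0$, $T_h(i,j)=(-1)^j(-q)^{\binom{j-h}{2}+hd}{d-h \brack d-j}_b{d-i \brack h}_b$, and $Q_j(i)=\sum_{h=0}^{\min\{j,d-i\}}T_h(i,j)$ is the $i$-th eigenvalue of the Hermitian forms graph $Q_q(d,j)$ ($d\times d$ Hermitian matrices over $\mathbb{F}_{q^2}$, adjacent iff their difference has rank $j$). -}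

module Defs where

open import Data.Nat as ℕ using (ℕ; zero; suc; _∸_; _⊔_; _⊓_; _≤_)
open import Data.Nat.Primality using (Prime)
open import Data.Integer as ℤ using (ℤ; +_; -_)
open import Data.Rational as ℚ using (ℚ; 0ℚ; 1ℚ; _÷_; ≢-nonZero)
open import Data.Rational.Properties using (_≟_; _<?_)
open import Data.Product using (∃; ∃-syntax; _×_)
open import Relation.Nullary using (yes; no)
open import Relation.Binary.PropositionalEquality using (_≡_)

IsPrimePower : ℕ → Set
IsPrimePower q = ∃[ p ] ∃[ k ] (Prime p × 1 ≤ k × q ≡ p ℕ.^ k)

ι : ℤ → ℚ
ι z = z ℚ./ 1

-- total division on ℚ (only ever used with nonzero divisors here)
_div_ : ℚ → ℚ → ℚ
x div y with y ≟ 0ℚ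
... | yes _ = 0ℚ
... | no y≢0 = _÷_ x y {{≢-nonZero y≢0}}

prod1 : ℕ → (ℕ → ℚ) → ℚ
prod1 zero    f = 1ℚ
prod1 (suc l) f = prod1 l f ℚ.* f (suc l)

sum0 : ℕ → (ℕ → ℚ) → ℚ
sum0 zero    f = f 0
sum0 (suc n) f = sum0 n f ℚ.+ f (suc n)

bb : ℕ → ℤ
bb q = - (+ q)

-- Gaussian binomial [m brack l]_b with b = -q (0 if l > m; l < 0 impossible for ℕ)
gbin : ℕ → ℕ → ℕ → ℚ
gbin q m l with l ℕ.≤? m
... | no _ = 0ℚ
... | yes _ = prod1 l (λ t → ι ((bb q ℤ.^ (m ∸ t ℕ.+ 1)) ℤ.- + 1) div ι ((bb q ℤ.^ t) ℤ.- + 1))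

choose2 : ℕ → ℕ
choose2 n = (n ℕ.* (n ∸ 1)) ℕ./ 2

-- T_h(i,j) for the Hermitian forms graph with parameters q, d
-- (used only for h ≤ j, so j - h is the natural-number difference)
T : (q d h i j : ℕ) → ℚ
T q d h i j =
  ι ((- + 1) ℤ.^ j) ℚ.* ι (bb q ℤ.^ (choose2 (j ∸ h) ℕ.+ h ℕ.* d))
    ℚ.* gbin q (d ∸ h) (d ∸ j) ℚ.* gbin q (d ∸ i) h

Q : (q d j i : ℕ) → ℚ
Q q d j i = sum0 (j ⊓ (d ∸ i)) (λ h → T q d h i j)

sgn : ℚ → ℤ
sgn x with x <? 0ℚ
... | yes _ = - + 1
... | no _ with x ≟ 0ℚ
...   | yes _ = + 0
...   | no _ = + 1

module Submission where

-- For j = 1 only h = 0, 1 contribute. Write b = -q, k = d - i and c = -1/(b - 1) = 1/(q + 1) > 0.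
-- From [m brack m]_b = 1 and [m brack 1]_b = [m brack m-1]_b = (b^m - 1)/(b - 1) one gets
-- T_0(i,1) = (b^d - 1) c and T_1(i,1) = b^d (b^k - 1) c, which telescope to
-- Q_1(i) = (b^(d+k) - 1) c. Passing from i + 1 to i multiplies x = b^(d+k-1) by b, and
-- |b x - 1| > |x - 1| as soon as |x| ≥ 3; and b^d b^k - 1 has the sign of b^d (b^k - 1)
-- because |b^d| ≥ 1 and |b^k| ≥ 2.

open import Defs
open import Data.Nat using (ℕ; _≤_; _∸_; _⊓_; _+_)
open import Data.Rational using (∣_∣; _<_)
open import Data.Product using (_×_)
open import Relation.Binary.PropositionalEquality using (_≡_)

open import Data.Nat as ℕ using (zero; suc; s≤s; z≤n)
import Data.Nat.Properties as ℕ
open import Data.Nat.Coprimality using (Coprime)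
open import Data.Nat.Divisibility using (∣1⇒≡1)
open import Data.Integer as ℤ using (ℤ; +_; +[1+_]; -[1+_]; 1ℤ)
import Data.Integer.Properties as ℤ
open import Data.Integer.Tactic.RingSolver using (solve-∀)
open import Data.Rational as ℚ using (ℚ; mkℚ; 0ℚ; 1ℚ; Positive; Negative)
import Data.Rational.Properties as ℚ
open import Data.Rational.Solver using (module +-*-Solver)
open import Data.Product using (_,_)
open import Data.Empty using (⊥-elim)
open import Data.Sum using (inj₂)
open import Relation.Nullary using (¬_; yes; no)
open import Relation.Binary.Definitions using (tri<; tri≈; tri>)
open import Relation.Binary.PropositionalEquality using (refl; sym; trans; cong; cong₂; subst; subst₂; module ≡-Reasoning)

coprime-1 : ∀ z → Coprime ℤ.∣ z ∣ 1
coprime-1 z (_ , d∣1) = ∣1⇒≡1 d∣1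

-- ι in normal form: unlike ι z, it computes once the constructor of z is known.
ι′ : ℤ → ℚ
ι′ z = mkℚ z 0 (coprime-1 z)

ι≡ι′ : ∀ z → ι z ≡ ι′ z
ι≡ι′ (+ n)    = ℚ.normalize-coprime {n} {0} (coprime-1 (+ n))
ι≡ι′ -[1+ n ] = cong ℚ.-_ (ℚ.normalize-coprime {suc n} {0} (coprime-1 (+ suc n)))

ι-homo-* : ∀ a b → ι (a ℤ.* b) ≡ ι a ℚ.* ι b
ι-homo-* a b rewrite ι≡ι′ a | ι≡ι′ b | ι≡ι′ (a ℤ.* b) = refl

ι-homo-+ : ∀ a b → ι (a ℤ.+ b) ≡ ι a ℚ.+ ι b
ι-homo-+ a b rewrite ι≡ι′ a | ι≡ι′ b | ℤ.*-identityʳ a | ℤ.*-identityʳ b = refl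

∣ι∣ : ∀ z → ℚ.∣ ι z ∣ ≡ ι (+ ℤ.∣ z ∣)
∣ι∣ z rewrite ι≡ι′ z | ι≡ι′ (+ ℤ.∣ z ∣) = refl

ι-mono-< : ∀ {m n} → m ℕ.< n → ι (+ m) ℚ.< ι (+ n)
ι-mono-< {m} {n} m<n rewrite ι≡ι′ (+ m) | ι≡ι′ (+ n) =
  ℚ.*<* (subst₂ ℤ._<_ (sym (ℤ.*-identityʳ (+ m))) (sym (ℤ.*-identityʳ (+ n))) (ℤ.+<+ m<n))

-- Total reciprocal, with 0 ⁻¹ = 0 like the total division _div_ of Defs.
_⁻¹ : ℚ → ℚ
y ⁻¹ = 1ℚ div y

div-≢0 : ∀ x {y} → ¬ y ≡ 0ℚ → x div y ≡ x ℚ.* y ⁻¹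
div-≢0 x {y} y≢0 with y ℚ.≟ 0ℚ
... | yes y≡0 = ⊥-elim (y≢0 y≡0)
... | no _    = cong (x ℚ.*_) (sym (ℚ.*-identityˡ _))

*-inverseʳ : ∀ {y} → ¬ y ≡ 0ℚ → y ℚ.* y ⁻¹ ≡ 1ℚ
*-inverseʳ {y} y≢0 with y ℚ.≟ 0ℚ
... | yes y≡0 = ⊥-elim (y≢0 y≡0)
... | no y≢0′ = trans (cong (y ℚ.*_) (ℚ.*-identityˡ _)) (ℚ.*-inverseʳ y {{ℚ.≢-nonZero y≢0′}})

x*y≡z⇒x≡z*y⁻¹ : ∀ {x y z} → ¬ y ≡ 0ℚ → x ℚ.* y ≡ z → x ≡ z ℚ.* y ⁻¹
x*y≡z⇒x≡z*y⁻¹ {x} {y} {z} y≢0 x*y≡z = begin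
  x                    ≡⟨ sym (ℚ.*-identityʳ x) ⟩
  x ℚ.* 1ℚ             ≡⟨ cong (x ℚ.*_) (sym (*-inverseʳ y≢0)) ⟩
  x ℚ.* (y ℚ.* y ⁻¹)   ≡⟨ sym (ℚ.*-assoc x y (y ⁻¹)) ⟩
  x ℚ.* y ℚ.* y ⁻¹     ≡⟨ cong (ℚ._* y ⁻¹) x*y≡z ⟩
  z ℚ.* y ⁻¹           ∎
  where open ≡-Reasoning

*-cancelʳ-≢0 : ∀ {x y z} → ¬ z ≡ 0ℚ → x ℚ.* z ≡ y ℚ.* z → x ≡ y
*-cancelʳ-≢0 {x} {y} {z} z≢0 xz≡yz = begin
  x                    ≡⟨ x*y≡z⇒x≡z*y⁻¹ z≢0 xz≡yz ⟩
  y ℚ.* z ℚ.* z ⁻¹     ≡⟨ ℚ.*-assoc y z (z ⁻¹) ⟩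
  y ℚ.* (z ℚ.* z ⁻¹)   ≡⟨ cong (y ℚ.*_) (*-inverseʳ z≢0) ⟩
  y ℚ.* 1ℚ             ≡⟨ ℚ.*-identityʳ y ⟩
  y                    ∎
  where open ≡-Reasoning

*-≢0 : ∀ {x y} → ¬ x ≡ 0ℚ → ¬ y ≡ 0ℚ → ¬ x ℚ.* y ≡ 0ℚ
*-≢0 {x} {y} x≢0 y≢0 xy≡0 = x≢0 (trans (x*y≡z⇒x≡z*y⁻¹ y≢0 xy≡0) (ℚ.*-zeroˡ (y ⁻¹)))

⁻¹-neg : ∀ y → Negative y → Negative (y ⁻¹)
⁻¹-neg y neg with y ℚ.≟ 0ℚ
... | yes refl = ⊥-elim (ℚ.<-irrefl refl (ℚ.negative⁻¹ y {{neg}}))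
... | no _     = subst Negative (sym (ℚ.*-identityˡ ((ℚ.1/ y) {{ℚ.neg⇒nonZero y {{neg}}}}))) (ℚ.1/neg⇒neg y {{neg}})

sgn-neg : ∀ x → x ℚ.< 0ℚ → sgn x ≡ ℤ.- 1ℤ
sgn-neg x x<0 with x ℚ.<? 0ℚ
... | yes _   = refl
... | no x≮0  = ⊥-elim (x≮0 x<0)

sgn-pos : ∀ x → 0ℚ ℚ.< x → sgn x ≡ 1ℤ
sgn-pos x 0<x with x ℚ.<? 0ℚ
... | yes x<0 = ⊥-elim (ℚ.<-asym x<0 0<x)
... | no _ with x ℚ.≟ 0ℚ
...   | yes refl = ⊥-elim (ℚ.<-irrefl refl 0<x)
...   | no _     = refl

sgn-*-pos : ∀ x c → Positive c → sgn (x ℚ.* c) ≡ sgn x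
sgn-*-pos x c pos with ℚ.<-cmp x 0ℚ
... | tri< x<0 _ _ = trans (sgn-neg (x ℚ.* c) (ℚ.negative⁻¹ _ {{xc<0}})) (sym (sgn-neg x x<0))
  where xc<0 = ℚ.neg*pos⇒neg x {{ℚ.negative x<0}} c {{pos}}
... | tri≈ _ refl _ = cong sgn (ℚ.*-zeroˡ c)
... | tri> _ _ 0<x = trans (sgn-pos (x ℚ.* c) (ℚ.positive⁻¹ _ {{0<xc}})) (sym (sgn-pos x 0<x))
  where 0<xc = ℚ.pos*pos⇒pos x {{ℚ.positive 0<x}} c {{pos}}

∣*-pos∣ : ∀ x c → Positive c → ℚ.∣ x ℚ.* c ∣ ≡ ℚ.∣ x ∣ ℚ.* c
∣*-pos∣ x c pos = trans (ℚ.∣p*q∣≡∣p∣*∣q∣ x c)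
  (cong (ℚ.∣ x ∣ ℚ.*_) (ℚ.0≤p⇒∣p∣≡p (ℚ.nonNegative⁻¹ c {{ℚ.pos⇒nonNeg c {{pos}}}})))

n<q^n : ∀ {q} → 1 ℕ.< q → ∀ n → n ℕ.< q ℕ.^ n
n<q^n 1<q zero    = s≤s z≤n
n<q^n 1<q (suc n) = ℕ.≤-<-trans (n<q^n 1<q n) (ℕ.^-monoʳ-< _ 1<q (ℕ.n<1+n n))

∣-q^n∣ : ∀ q n → ℤ.∣ bb q ℤ.^ n ∣ ≡ q ℕ.^ n
∣-q^n∣ q zero    = refl
∣-q^n∣ q (suc n) = begin
  ℤ.∣ bb q ℤ.* bb q ℤ.^ n ∣          ≡⟨ ℤ.abs-* (bb q) (bb q ℤ.^ n) ⟩
  ℤ.∣ bb q ∣ ℕ.* ℤ.∣ bb q ℤ.^ n ∣    ≡⟨ cong₂ ℕ._*_ (ℤ.∣-i∣≡∣i∣ (+ q)) (∣-q^n∣ q n) ⟩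
  q ℕ.* q ℕ.^ n                      ∎
  where open ≡-Reasoning

n<∣-q^n∣ : ∀ {q} → 2 ≤ q → ∀ n → n ℕ.< ℤ.∣ bb q ℤ.^ n ∣
n<∣-q^n∣ {q} 2≤q n = subst (n ℕ.<_) (sym (∣-q^n∣ q n)) (n<q^n 2≤q n)

-- Once the signs of x and y are fixed, both sides compute.
sgn-ι′[x*y-1] : ∀ x y → 1 ≤ ℤ.∣ x ∣ → 2 ≤ ℤ.∣ y ∣ →
                sgn (ι′ (x ℤ.* y ℤ.- 1ℤ)) ≡ sgn (ι′ (x ℤ.* (y ℤ.- 1ℤ)))
sgn-ι′[x*y-1] +[1+ _ ] +[1+ suc _ ] _ _ = refl
sgn-ι′[x*y-1] +[1+ _ ] -[1+ suc _ ] _ _ = refl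
sgn-ι′[x*y-1] -[1+ _ ] +[1+ suc _ ] _ _ = refl
sgn-ι′[x*y-1] -[1+ _ ] -[1+ suc _ ] _ _ = refl
sgn-ι′[x*y-1] (+ 0)    _            () _
sgn-ι′[x*y-1] _        (+ 0)        _  ()
sgn-ι′[x*y-1] _        +[1+ 0 ]     _  (s≤s ())
sgn-ι′[x*y-1] _        -[1+ 0 ]     _  (s≤s ())

∣x-1∣<∣-qx-1∣ : ∀ {q x} → 2 ≤ q → 3 ≤ ℤ.∣ x ∣ → ℤ.∣ x ℤ.- 1ℤ ∣ ℕ.< ℤ.∣ bb q ℤ.* x ℤ.- 1ℤ ∣
∣x-1∣<∣-qx-1∣ {suc (suc q)} {+[1+ suc (suc m) ]} _ _ =
  s≤s (s≤s (s≤s (ℕ.m≤n⇒m≤1+n (ℕ.≤-trans (ℕ.m≤m+n m _) (ℕ.m≤m+n _ 0)))))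
∣x-1∣<∣-qx-1∣ {suc (suc q)} { -[1+ suc (suc m) ]} _ _ = s≤s (s≤s (begin
  3 ℕ.+ (m ℕ.+ 0)            ≡⟨ cong (3 ℕ.+_) (ℕ.+-identityʳ m) ⟩
  3 ℕ.+ m                    ≤⟨ ℕ.m≤n+m (3 ℕ.+ m) m ⟩
  m ℕ.+ (3 ℕ.+ m)            ≤⟨ ℕ.+-monoʳ-≤ m (ℕ.m≤m+n (3 ℕ.+ m) _) ⟩
  m ℕ.+ suc q ℕ.* (3 ℕ.+ m)  ∎))
  where open ℕ.≤-Reasoning
∣x-1∣<∣-qx-1∣ {zero} () _
∣x-1∣<∣-qx-1∣ {suc zero} (s≤s ()) _
∣x-1∣<∣-qx-1∣ {x = + 0}        _ ()
∣x-1∣<∣-qx-1∣ {x = +[1+ 0 ]}   _ (s≤s ())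
∣x-1∣<∣-qx-1∣ {x = +[1+ 1 ]}   _ (s≤s (s≤s ()))
∣x-1∣<∣-qx-1∣ {x = -[1+ 0 ]}   _ (s≤s ())
∣x-1∣<∣-qx-1∣ {x = -[1+ 1 ]}   _ (s≤s (s≤s ()))

ι≡0⇒≡0 : ∀ {z} → ι z ≡ 0ℚ → z ≡ + 0
ι≡0⇒≡0 {z} ιz≡0 = cong ℚ.↥_ (trans (sym (ι≡ι′ z)) ιz≡0)

-- Φ! q k = ∏_{t=1}^{k} (b^t - 1) is (b - 1)^k times the b-analogue of k!.
Φ : ℕ → ℕ → ℚ
Φ q s = ι (bb q ℤ.^ s ℤ.- 1ℤ)

Φ! : ℕ → ℕ → ℚ
Φ! q k = prod1 k (Φ q)

Φ≢0 : ∀ {q} s → 2 ≤ q → ¬ Φ q (suc s) ≡ 0ℚ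
Φ≢0 {q} s 2≤q Φ≡0
  with ℕ.m^n≡1⇒n≡0∨m≡1 q (suc s)
         (trans (sym (∣-q^n∣ q (suc s))) (cong ℤ.∣_∣ (ℤ.i-j≡0⇒i≡j (bb q ℤ.^ suc s) 1ℤ (ι≡0⇒≡0 Φ≡0))))
... | inj₂ refl = ℕ.<-irrefl refl 2≤q

Φ!≢0 : ∀ {q} k → 2 ≤ q → ¬ Φ! q k ≡ 0ℚ
Φ!≢0 zero    _   = ℚ.1≢0
Φ!≢0 (suc k) 2≤q = *-≢0 (Φ!≢0 k 2≤q) (Φ≢0 k 2≤q)

gbin-≤ : ∀ q m l → l ≤ m → gbin q m l ≡ prod1 l (λ t → Φ q (m ∸ t ℕ.+ 1) div Φ q t)
gbin-≤ q m l l≤m with l ℕ.≤? m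
... | yes _  = refl
... | no l≰m = ⊥-elim (l≰m l≤m)

gbin-factorial : ∀ q m l → 2 ≤ q → l ≤ m → gbin q m l ℚ.* Φ! q (m ∸ l) ℚ.* Φ! q l ≡ Φ! q m
gbin-factorial q m l 2≤q l≤m rewrite gbin-≤ q m l l≤m = go l l≤m
  where
  open +-*-Solver
  open ≡-Reasoning
  P : ℕ → ℚ
  P l = prod1 l (λ t → Φ q (m ∸ t ℕ.+ 1) div Φ q t)
  go : ∀ l → l ≤ m → P l ℚ.* Φ! q (m ∸ l) ℚ.* Φ! q l ≡ Φ! q m
  go zero    _   = trans (ℚ.*-identityʳ _) (ℚ.*-identityˡ _)
  go (suc l) l<m = begin
    P l ℚ.* (Φ q (k ℕ.+ 1) div Φ q (suc l)) ℚ.* Φ! q k ℚ.* (Φ! q l ℚ.* Φ q (suc l))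
      ≡⟨ cong (λ x → P l ℚ.* x ℚ.* Φ! q k ℚ.* (Φ! q l ℚ.* Φ q (suc l))) Φ[k+1]/Φ[l+1] ⟩
    P l ℚ.* (Φ q (suc k) ℚ.* Φ q (suc l) ⁻¹) ℚ.* Φ! q k ℚ.* (Φ! q l ℚ.* Φ q (suc l))
      ≡⟨ solve 6 (λ p a i f g e → p :* (a :* i) :* f :* (g :* e) := (p :* (f :* a) :* g) :* (e :* i)) refl
           (P l) (Φ q (suc k)) (Φ q (suc l) ⁻¹) (Φ! q k) (Φ! q l) (Φ q (suc l)) ⟩
    P l ℚ.* Φ! q (suc k) ℚ.* Φ! q l ℚ.* (Φ q (suc l) ℚ.* Φ q (suc l) ⁻¹)
      ≡⟨ cong₂ ℚ._*_ (subst (λ n → P l ℚ.* Φ! q n ℚ.* Φ! q l ≡ Φ! q m) m∸l≡1+k (go l (ℕ.<⇒≤ l<m)))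
                     (*-inverseʳ (Φ≢0 l 2≤q)) ⟩
    Φ! q m ℚ.* 1ℚ
      ≡⟨ ℚ.*-identityʳ _ ⟩
    Φ! q m ∎
    where
    k = m ∸ suc l
    m∸l≡1+k : m ∸ l ≡ suc k
    m∸l≡1+k = ℕ.+-∸-assoc 1 l<m
    Φ[k+1]/Φ[l+1] : Φ q (k ℕ.+ 1) div Φ q (suc l) ≡ Φ q (suc k) ℚ.* Φ q (suc l) ⁻¹
    Φ[k+1]/Φ[l+1] = trans (cong (λ n → Φ q n div Φ q (suc l)) (ℕ.+-comm k 1)) (div-≢0 _ (Φ≢0 l 2≤q))

gbin-diag : ∀ q m → 2 ≤ q → gbin q m m ≡ 1ℚ
gbin-diag q m 2≤q = begin
  gbin q m m             ≡⟨ x*y≡z⇒x≡z*y⁻¹ {z = Φ! q m} (Φ!≢0 m 2≤q) gbin*Φ!≡Φ! ⟩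
  Φ! q m ℚ.* Φ! q m ⁻¹   ≡⟨ *-inverseʳ (Φ!≢0 m 2≤q) ⟩
  1ℚ                     ∎
  where
  open ≡-Reasoning
  gbin*Φ!≡Φ! : gbin q m m ℚ.* Φ! q m ≡ Φ! q m
  gbin*Φ!≡Φ! = begin
    gbin q m m ℚ.* Φ! q m
      ≡⟨ cong (ℚ._* Φ! q m) (sym (ℚ.*-identityʳ (gbin q m m))) ⟩
    gbin q m m ℚ.* Φ! q 0 ℚ.* Φ! q m
      ≡⟨ cong (λ n → gbin q m m ℚ.* Φ! q n ℚ.* Φ! q m) (sym (ℕ.n∸n≡0 m)) ⟩
    gbin q m m ℚ.* Φ! q (m ∸ m) ℚ.* Φ! q m
      ≡⟨ gbin-factorial q m m 2≤q ℕ.≤-refl ⟩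
    Φ! q m ∎

gbin-one : ∀ q k → 2 ≤ q → gbin q (suc k) 1 ≡ Φ q (suc k) ℚ.* Φ q 1 ⁻¹
gbin-one q k 2≤q = begin
  gbin q (suc k) 1                    ≡⟨ gbin-≤ q (suc k) 1 (s≤s z≤n) ⟩
  1ℚ ℚ.* (Φ q (k ℕ.+ 1) div Φ q 1)    ≡⟨ ℚ.*-identityˡ _ ⟩
  Φ q (k ℕ.+ 1) div Φ q 1             ≡⟨ cong (λ n → Φ q n div Φ q 1) (ℕ.+-comm k 1) ⟩
  Φ q (suc k) div Φ q 1               ≡⟨ div-≢0 _ (Φ≢0 0 2≤q) ⟩
  Φ q (suc k) ℚ.* Φ q 1 ⁻¹            ∎
  where open ≡-Reasoning

gbin-pred : ∀ q k → 2 ≤ q → gbin q (suc k) k ≡ Φ q (suc k) ℚ.* Φ q 1 ⁻¹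
gbin-pred q k 2≤q =
  x*y≡z⇒x≡z*y⁻¹ {z = Φ q (suc k)} (Φ≢0 0 2≤q) (*-cancelʳ-≢0 {y = Φ q (suc k)} (Φ!≢0 k 2≤q) gbin*Φ₁*Φ!≡Φ*Φ!)
  where
  open ≡-Reasoning
  gbin*Φ₁*Φ!≡Φ*Φ! : gbin q (suc k) k ℚ.* Φ q 1 ℚ.* Φ! q k ≡ Φ q (suc k) ℚ.* Φ! q k
  gbin*Φ₁*Φ!≡Φ*Φ! = begin
    gbin q (suc k) k ℚ.* Φ q 1 ℚ.* Φ! q k
      ≡⟨ cong (λ x → gbin q (suc k) k ℚ.* x ℚ.* Φ! q k) (sym (ℚ.*-identityˡ (Φ q 1))) ⟩
    gbin q (suc k) k ℚ.* Φ! q 1 ℚ.* Φ! q k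
      ≡⟨ cong (λ n → gbin q (suc k) k ℚ.* Φ! q n ℚ.* Φ! q k) (sym (ℕ.m+n∸n≡m 1 k)) ⟩
    gbin q (suc k) k ℚ.* Φ! q (suc k ∸ k) ℚ.* Φ! q k
      ≡⟨ gbin-factorial q (suc k) k 2≤q (ℕ.n≤1+n k) ⟩
    Φ! q k ℚ.* Φ q (suc k)
      ≡⟨ ℚ.*-comm (Φ! q k) (Φ q (suc k)) ⟩
    Φ q (suc k) ℚ.* Φ! q k ∎

-- The factor (-1)^1 / (b - 1) = 1 / (q + 1) common to every T_h(i, 1).
c : ℕ → ℚ
c q = ℚ.- 1ℚ ℚ.* Φ q 1 ⁻¹

Φ₁-neg : ∀ {q} → 2 ≤ q → Negative (Φ q 1)
Φ₁-neg {suc (suc q)} _ rewrite ι≡ι′ (bb (suc (suc q)) ℤ.^ 1 ℤ.- 1ℤ) = _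
Φ₁-neg {suc zero} (s≤s ())

c-pos : ∀ {q} → 2 ≤ q → Positive (c q)
c-pos {q} 2≤q = ℚ.neg*neg⇒pos (ℚ.- 1ℚ) (Φ q 1 ⁻¹) {{⁻¹-neg (Φ q 1) (Φ₁-neg 2≤q)}}

T₀-closed : ∀ q d i → 2 ≤ q → T q (suc d) 0 i 1 ≡ ι (bb q ℤ.^ suc d ℤ.- 1ℤ) ℚ.* c q
T₀-closed q d i 2≤q = begin
  ℚ.- 1ℚ ℚ.* 1ℚ ℚ.* gbin q (suc d) d ℚ.* 1ℚ
    ≡⟨ cong (λ x → ℚ.- 1ℚ ℚ.* 1ℚ ℚ.* x ℚ.* 1ℚ) (gbin-pred q d 2≤q) ⟩
  ℚ.- 1ℚ ℚ.* 1ℚ ℚ.* (Φ q (suc d) ℚ.* Φ q 1 ⁻¹) ℚ.* 1ℚ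
    ≡⟨ solve 3 (λ m x i → m :* con 1ℚ :* (x :* i) :* con 1ℚ := x :* (m :* i)) refl
         (ℚ.- 1ℚ) (Φ q (suc d)) (Φ q 1 ⁻¹) ⟩
  Φ q (suc d) ℚ.* c q ∎
  where
  open +-*-Solver
  open ≡-Reasoning

T₁-closed : ∀ q d i k → 2 ≤ q → suc d ∸ i ≡ suc k →
            T q (suc d) 1 i 1 ≡ ι (bb q ℤ.^ suc d ℤ.* (bb q ℤ.^ suc k ℤ.- 1ℤ)) ℚ.* c q
T₁-closed q d i k 2≤q d∸i≡1+k = begin
  ℚ.- 1ℚ ℚ.* ι (bb q ℤ.^ (suc d ℕ.+ 0)) ℚ.* gbin q d d ℚ.* gbin q (suc d ∸ i) 1
    ≡⟨ cong (λ n → ℚ.- 1ℚ ℚ.* ι (bb q ℤ.^ n) ℚ.* gbin q d d ℚ.* gbin q (suc d ∸ i) 1) (ℕ.+-identityʳ (suc d)) ⟩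
  ℚ.- 1ℚ ℚ.* x ℚ.* gbin q d d ℚ.* gbin q (suc d ∸ i) 1
    ≡⟨ cong (λ g → ℚ.- 1ℚ ℚ.* x ℚ.* g ℚ.* gbin q (suc d ∸ i) 1) (gbin-diag q d 2≤q) ⟩
  ℚ.- 1ℚ ℚ.* x ℚ.* 1ℚ ℚ.* gbin q (suc d ∸ i) 1
    ≡⟨ cong (λ n → ℚ.- 1ℚ ℚ.* x ℚ.* 1ℚ ℚ.* gbin q n 1) d∸i≡1+k ⟩
  ℚ.- 1ℚ ℚ.* x ℚ.* 1ℚ ℚ.* gbin q (suc k) 1
    ≡⟨ cong (λ g → ℚ.- 1ℚ ℚ.* x ℚ.* 1ℚ ℚ.* g) (gbin-one q k 2≤q) ⟩
  ℚ.- 1ℚ ℚ.* x ℚ.* 1ℚ ℚ.* (Φ q (suc k) ℚ.* Φ q 1 ⁻¹)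
    ≡⟨ solve 4 (λ m x y i → m :* x :* con 1ℚ :* (y :* i) := x :* y :* (m :* i)) refl
         (ℚ.- 1ℚ) x (Φ q (suc k)) (Φ q 1 ⁻¹) ⟩
  x ℚ.* Φ q (suc k) ℚ.* c q
    ≡⟨ cong (ℚ._* c q) (sym (ι-homo-* (bb q ℤ.^ suc d) _)) ⟩
  ι (bb q ℤ.^ suc d ℤ.* (bb q ℤ.^ suc k ℤ.- 1ℤ)) ℚ.* c q ∎
  where
  open +-*-Solver
  open ≡-Reasoning
  x = ι (bb q ℤ.^ suc d)

Q₁-closed : ∀ q d i k → 2 ≤ q → suc d ∸ i ≡ k → Q q (suc d) 1 i ≡ ι (bb q ℤ.^ (suc d ℕ.+ k) ℤ.- 1ℤ) ℚ.* c q
Q₁-closed q d i zero 2≤q d∸i≡0 = begin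
  Q q (suc d) 1 i
    ≡⟨ cong (λ n → sum0 (1 ⊓ n) (λ h → T q (suc d) h i 1)) d∸i≡0 ⟩
  T q (suc d) 0 i 1
    ≡⟨ T₀-closed q d i 2≤q ⟩
  ι (bb q ℤ.^ suc d ℤ.- 1ℤ) ℚ.* c q
    ≡⟨ cong (λ n → ι (bb q ℤ.^ n ℤ.- 1ℤ) ℚ.* c q) (sym (ℕ.+-identityʳ (suc d))) ⟩
  ι (bb q ℤ.^ (suc d ℕ.+ 0) ℤ.- 1ℤ) ℚ.* c q ∎
  where open ≡-Reasoning
Q₁-closed q d i (suc k) 2≤q d∸i≡1+k = begin
  Q q (suc d) 1 i
    ≡⟨ cong (λ n → sum0 (1 ⊓ n) (λ h → T q (suc d) h i 1)) d∸i≡1+k ⟩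
  T q (suc d) 0 i 1 ℚ.+ T q (suc d) 1 i 1
    ≡⟨ cong₂ ℚ._+_ (T₀-closed q d i 2≤q) (T₁-closed q d i k 2≤q d∸i≡1+k) ⟩
  ι (x ℤ.- 1ℤ) ℚ.* c q ℚ.+ ι (x ℤ.* (y ℤ.- 1ℤ)) ℚ.* c q
    ≡⟨ sym (ℚ.*-distribʳ-+ (c q) (ι (x ℤ.- 1ℤ)) (ι (x ℤ.* (y ℤ.- 1ℤ)))) ⟩
  (ι (x ℤ.- 1ℤ) ℚ.+ ι (x ℤ.* (y ℤ.- 1ℤ))) ℚ.* c q
    ≡⟨ cong (ℚ._* c q) (sym (ι-homo-+ (x ℤ.- 1ℤ) _)) ⟩
  ι (x ℤ.- 1ℤ ℤ.+ x ℤ.* (y ℤ.- 1ℤ)) ℚ.* c q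
    ≡⟨ cong (λ z → ι z ℚ.* c q) (telescope x y) ⟩
  ι (x ℤ.* y ℤ.- 1ℤ) ℚ.* c q
    ≡⟨ cong (λ z → ι (z ℤ.- 1ℤ) ℚ.* c q) (sym (ℤ.^-distribˡ-+-* (bb q) (suc d) (suc k))) ⟩
  ι (bb q ℤ.^ (suc d ℕ.+ suc k) ℤ.- 1ℤ) ℚ.* c q ∎
  where
  open ≡-Reasoning
  x = bb q ℤ.^ suc d
  y = bb q ℤ.^ suc k
  telescope : ∀ x y → x ℤ.- 1ℤ ℤ.+ x ℤ.* (y ℤ.- 1ℤ) ≡ x ℤ.* y ℤ.- 1ℤ
  telescope = solve-∀

∣ι*pos∣-mono : ∀ z w {c} → Positive c → ℤ.∣ z ∣ ℕ.< ℤ.∣ w ∣ → ℚ.∣ ι z ℚ.* c ∣ ℚ.< ℚ.∣ ι w ℚ.* c ∣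
∣ι*pos∣-mono z w {c} pos ∣z∣<∣w∣
  rewrite ∣*-pos∣ (ι z) c pos | ∣*-pos∣ (ι w) c pos | ∣ι∣ z | ∣ι∣ w =
  ℚ.*-monoˡ-<-pos c {{pos}} (ι-mono-< ∣z∣<∣w∣)

sgn-ι[x*y-1]*pos : ∀ x y {c} → Positive c → 1 ≤ ℤ.∣ x ∣ → 2 ≤ ℤ.∣ y ∣ →
                   sgn (ι (x ℤ.* y ℤ.- 1ℤ) ℚ.* c) ≡ sgn (ι (x ℤ.* (y ℤ.- 1ℤ)) ℚ.* c)
sgn-ι[x*y-1]*pos x y {c} pos 1≤∣x∣ 2≤∣y∣
  rewrite sgn-*-pos (ι (x ℤ.* y ℤ.- 1ℤ)) c pos | sgn-*-pos (ι (x ℤ.* (y ℤ.- 1ℤ))) c pos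
        | ι≡ι′ (x ℤ.* y ℤ.- 1ℤ) | ι≡ι′ (x ℤ.* (y ℤ.- 1ℤ)) =
  sgn-ι′[x*y-1] x y 1≤∣x∣ 2≤∣y∣

∣Q₁∣-decreasing : ∀ q d i → 2 ≤ q → 1 ≤ d → i ≤ d → ∣ Q q (suc d) 1 (i + 1) ∣ < ∣ Q q (suc d) 1 i ∣
∣Q₁∣-decreasing q d i 2≤q 1≤d i≤d = subst₂ (λ a b → ∣ a ∣ < ∣ b ∣) (sym Q[i+1]≡) (sym Q[i]≡)
  (∣ι*pos∣-mono (x ℤ.- 1ℤ) (bb q ℤ.* x ℤ.- 1ℤ) (c-pos 2≤q) (∣x-1∣<∣-qx-1∣ {x = x} 2≤q 3≤∣x∣))
  where
  k = d ∸ i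
  x = bb q ℤ.^ (suc d ℕ.+ k)
  3≤∣x∣ : 3 ≤ ℤ.∣ x ∣
  3≤∣x∣ = ℕ.≤-trans (s≤s (s≤s (ℕ.≤-trans 1≤d (ℕ.m≤m+n d k)))) (n<∣-q^n∣ 2≤q (suc d ℕ.+ k))
  Q[i+1]≡ : Q q (suc d) 1 (i + 1) ≡ ι (x ℤ.- 1ℤ) ℚ.* c q
  Q[i+1]≡ = Q₁-closed q d (i + 1) k 2≤q (cong (suc d ∸_) (ℕ.+-comm i 1))
  Q[i]≡ : Q q (suc d) 1 i ≡ ι (bb q ℤ.* x ℤ.- 1ℤ) ℚ.* c q
  Q[i]≡ = trans (Q₁-closed q d i (suc k) 2≤q (ℕ.+-∸-assoc 1 i≤d))
                (cong (λ n → ι (bb q ℤ.^ n ℤ.- 1ℤ) ℚ.* c q) (ℕ.+-suc (suc d) k))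

sgn-Q₁≡sgn-T : ∀ q d i → 2 ≤ q → i ≤ d → sgn (Q q (suc d) 1 i) ≡ sgn (T q (suc d) (1 ⊓ (suc d ∸ i)) i 1)
sgn-Q₁≡sgn-T q d i 2≤q i≤d = begin
  sgn (Q q (suc d) 1 i)
    ≡⟨ cong sgn (Q₁-closed q d i (suc k) 2≤q d∸i≡1+k) ⟩
  sgn (ι (bb q ℤ.^ (suc d ℕ.+ suc k) ℤ.- 1ℤ) ℚ.* c q)
    ≡⟨ cong (λ z → sgn (ι (z ℤ.- 1ℤ) ℚ.* c q)) (ℤ.^-distribˡ-+-* (bb q) (suc d) (suc k)) ⟩
  sgn (ι (x ℤ.* y ℤ.- 1ℤ) ℚ.* c q)
    ≡⟨ sgn-ι[x*y-1]*pos x y (c-pos 2≤q)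
         (ℕ.≤-trans (s≤s z≤n) (n<∣-q^n∣ 2≤q (suc d))) (ℕ.≤-trans (s≤s (s≤s z≤n)) (n<∣-q^n∣ 2≤q (suc k))) ⟩
  sgn (ι (x ℤ.* (y ℤ.- 1ℤ)) ℚ.* c q)
    ≡⟨ cong sgn (sym (T₁-closed q d i k 2≤q d∸i≡1+k)) ⟩
  sgn (T q (suc d) 1 i 1)
    ≡⟨ cong (λ n → sgn (T q (suc d) (1 ⊓ n) i 1)) (sym d∸i≡1+k) ⟩
  sgn (T q (suc d) (1 ⊓ (suc d ∸ i)) i 1) ∎
  where
  open ≡-Reasoning
  k = d ∸ i
  d∸i≡1+k : suc d ∸ i ≡ suc k
  d∸i≡1+k = ℕ.+-∸-assoc 1 i≤d
  x = bb q ℤ.^ suc d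
  y = bb q ℤ.^ suc k

lemma5p1 : (q d i : ℕ) → IsPrimePower q → 2 ≤ q → 6 ≤ d → 1 ≤ i → i ≤ d ∸ 1 →
    (∣ Q q d 1 (i + 1) ∣ < ∣ Q q d 1 i ∣)
      × (sgn (Q q d 1 i) ≡ sgn (T q d (1 ⊓ (d ∸ i)) i 1))
lemma5p1 q zero    i _ _   ()  _ _
lemma5p1 q (suc d) i _ 2≤q 6≤d _ i≤d = ∣Q₁∣-decreasing q d i 2≤q 1≤d i≤d , sgn-Q₁≡sgn-T q d i 2≤q i≤d
  where
  1≤d : 1 ≤ d
  1≤d = ℕ.≤-pred (ℕ.≤-trans (s≤s (s≤s z≤n)) 6≤d)
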